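{- Let $\ell_1,\ell_2$ be distinct lines of $\mathcal{L}_3$ such that the point $\ell_1\cap\ell_2$ belongs to $\mathcal{O}_2$. Then the line $\ell_1^\mu\ell_2^\mu$ of $\mathrm{PG}(2,q^3)$ belongs to $\mathcal{L}_2$.
   Context: Let $q>2$ be a prime power and $\alpha$ a collineation of order $3$ of $\mathrm{PG}(2,q^3)$ whose fixed points form a subplane isomorphic to $\mathrm{PG}(2,q)$. A point $x$ is in $\mathcal{O}_1$ if $x^\alpha=x$, in $\mathcal{O}_2$ if $x,x^\alpha,x^{\alpha^2}$ are distinct and collinear, and in $\mathcal{O}_3$ if $x,x^\alpha,x^{\alpha^2}$ are distinct and not collinear; line classes $\mathcal{L}_1,\mathcal{L}_2,\mathcal{L}_3$ are defined dually. The bijection $\mu$ between $\mathcal{O}_3$ and $\mathcal{L}_3$ is $x^\mu=x^\alpha x^{\alpha^2}$ (the line through $x^\alpha,x^{\alpha^2}$) and $\ell^\mu=\ell^\alpha\cap\ell^{\alpha^2}$. The Figueroa plane $\mathcal{F}$ has the same points as $\mathrm{PG}(2,q^3)$; its lines are the lines of $\mathcal{L}_1\cup\mathcal{L}_2$ (unchanged as point sets) and, for each $\ell\in\mathcal{L}_3$, the line $\ell_{\mathcal{F}}$ consisting of the points of $\ell$ in $\mathcal{O}_1\cup\mathcal{O}_2$ together with the points $P\in\mathcal{O}_3$ with $\ell^\mu\in P^\mu$. -}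

module Defs where

open import Level using (Level; _⊔_)
open import Algebra.Bundles using (CommutativeRing)
open import Data.Nat using (ℕ; _^_; _≤_)
open import Data.Nat.Primality using (Prime)
open import Data.Fin using (Fin)
open import Data.Product using (Σ; ∃; _×_; _,_)
open import Relation.Nullary using (¬_)
open import Relation.Binary.PropositionalEquality using (_≡_)

IsPrimePower : ℕ → Set
IsPrimePower q = ∃ λ p → ∃ λ k → Prime p × (1 ≤ k) × (q ≡ p ^ k)

module _ {c ℓ : Level} (R : CommutativeRing c ℓ) where
  open CommutativeRing R

  IsField : Set (c ⊔ ℓ)
  IsField = (¬ (1# ≈ 0#)) × (∀ x → ¬ (x ≈ 0#) → ∃ λ y → x * y ≈ 1#)

  HasSize : ℕ → Set (c ⊔ ℓ)
  HasSize n = Σ (Fin n → Carrier) λ f →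
                (∀ i j → f i ≈ f j → i ≡ j) × (∀ x → ∃ λ i → f i ≈ x)

  record Vec3 : Set (c ⊔ ℓ) where
    constructor ⟨_,_,_⟩∶_
    field
      x₀ x₁ x₂ : Carrier
      nonzero : ¬ ((x₀ ≈ 0#) × (x₁ ≈ 0#) × (x₂ ≈ 0#))
  open Vec3 public

  -- Points and lines of PG(2,R) are both given by nonzero vectors,
  -- identified up to nonzero scalar multiples.
  Point : Set (c ⊔ ℓ)
  Point = Vec3

  Line : Set (c ⊔ ℓ)
  Line = Vec3

  _∼_ : Vec3 → Vec3 → Set (c ⊔ ℓ)
  u ∼ v = ∃ λ λ′ → (¬ (λ′ ≈ 0#)) ×
            ((x₀ u ≈ λ′ * x₀ v) × (x₁ u ≈ λ′ * x₁ v) × (x₂ u ≈ λ′ * x₂ v))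

  _I_ : Point → Line → Set ℓ
  p I l = (x₀ p * x₀ l + x₁ p * x₁ l) + x₂ p * x₂ l ≈ 0#

  Collinear : Point → Point → Point → Set (c ⊔ ℓ)
  Collinear x y z = ∃ λ (l : Line) → (x I l) × (y I l) × (z I l)

  Concurrent : Line → Line → Line → Set (c ⊔ ℓ)
  Concurrent l m n = ∃ λ (p : Point) → (p I l) × (p I m) × (p I n)

  record Collineation : Set (c ⊔ ℓ) where
    field
      pt : Point → Point
      ln : Line → Line
      pt-cong : ∀ {x y} → x ∼ y → pt x ∼ pt y
      ln-cong : ∀ {l m} → l ∼ m → ln l ∼ ln m
      pt-inj : ∀ {x y} → pt x ∼ pt y → x ∼ y
      ln-inj : ∀ {l m} → ln l ∼ ln m → l ∼ m
      pt-surj : ∀ y → ∃ λ x → pt x ∼ y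
      ln-surj : ∀ m → ∃ λ l → ln l ∼ m
      incidence : ∀ x l → (x I l → pt x I ln l) × (pt x I ln l → x I l)

-- Setting: F = GF(q^3) (given abstractly), α a collineation of PG(2,F).
module Setting {c ℓ : Level} (F : CommutativeRing c ℓ) (α : Collineation F) where
  open Collineation α
  private
    _≃_ = _∼_ F

  pt² pt³ : Point F → Point F
  pt² x = pt (pt x)
  pt³ x = pt (pt (pt x))

  ln² : Line F → Line F
  ln² l = ln (ln l)

  HasOrder3 : Set (c ⊔ ℓ)
  HasOrder3 = (∀ x → pt³ x ≃ x) × (∃ λ x → ¬ (pt x ≃ x))

  FixedSubplaneIso : {c′ ℓ′ : Level} (K : CommutativeRing c′ ℓ′) → Set (c ⊔ ℓ ⊔ c′ ⊔ ℓ′)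
  FixedSubplaneIso K =
    Σ (Point K → Point F) λ φ →
      (∀ x y → _∼_ K x y → φ x ≃ φ y) ×
      (∀ x y → φ x ≃ φ y → _∼_ K x y) ×
      (∀ x → pt (φ x) ≃ φ x) ×
      (∀ y → pt y ≃ y → ∃ λ x → φ x ≃ y) ×
      (∀ x y z → (Collinear K x y z → Collinear F (φ x) (φ y) (φ z)) ×
                 (Collinear F (φ x) (φ y) (φ z) → Collinear K x y z))

  𝒪₁ 𝒪₂ 𝒪₃ : Point F → Set (c ⊔ ℓ)
  𝒪₁ x = pt x ≃ x
  𝒪₂ x = (¬ (x ≃ pt x)) × (¬ (pt x ≃ pt² x)) × (¬ (x ≃ pt² x)) × Collinear F x (pt x) (pt² x)
  𝒪₃ x = (¬ (x ≃ pt x)) × (¬ (pt x ≃ pt² x)) × (¬ (x ≃ pt² x)) × ¬ Collinear F x (pt x) (pt² x)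

  ℒ₁ ℒ₂ ℒ₃ : Line F → Set (c ⊔ ℓ)
  ℒ₁ l = ln l ≃ l
  ℒ₂ l = (¬ (l ≃ ln l)) × (¬ (ln l ≃ ln² l)) × (¬ (l ≃ ln² l)) × Concurrent F l (ln l) (ln² l)
  ℒ₃ l = (¬ (l ≃ ln l)) × (¬ (ln l ≃ ln² l)) × (¬ (l ≃ ln² l)) × ¬ Concurrent F l (ln l) (ln² l)

  IsMu : Line F → Point F → Set ℓ
  IsMu l P = (_I_ F P (ln l)) × (_I_ F P (ln² l))

{-# OPTIONS --safe #-}
module Submission where

-- The orbit X, X^α, X^α² of X ∈ 𝒪₂ lies on a line n fixed by α. The triangles with sides
-- ℓ₁, ℓ₁^α, ℓ₁^α² and ℓ₂, ℓ₂^α, ℓ₂^α² are therefore in perspective from the axis n, their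
-- corresponding sides meeting in X, X^α, X^α². Their vertices are the orbits of ℓ₁^μ and ℓ₂^μ,
-- so by Desargues' theorem the lines joining corresponding vertices, namely m = ℓ₁^μ ℓ₂^μ,
-- m^α and m^α², are concurrent. They are distinct because the vertices of the triangle of
-- ℓ₁ ∈ ℒ₃ are not collinear, hence m ∈ ℒ₂.
--
-- Desargues' theorem is proved in coordinates: each side M through a point of n is rescaled
-- to M ≃ ν L + n, where L is the corresponding side of the other triangle; the line joining
-- the vertices L ∩ L′ and M ∩ M′ is then ν L − ν′ L′, and the three joining lines sum to zero.

open import Algebra.Bundles using (CommutativeRing)
open import Data.Empty using (⊥; ⊥-elim)
import Data.Fin.Properties as Fin
open import Data.Integer using (+_)
open import Data.Nat using (ℕ; _^_; _<_)
open import Data.Product using (∃; ∃₂; _×_; _,_; proj₁; proj₂)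
open import Data.Product.Relation.Binary.Pointwise.NonDependent using (×-setoid)
open import Data.Sum using (_⊎_; inj₁; inj₂)
open import Level using (Level; _⊔_)
open import Relation.Binary.Bundles using (Setoid)
open import Relation.Binary.Definitions using (Decidable)
import Relation.Binary.PropositionalEquality as ≡
import Relation.Binary.Reasoning.Setoid
open import Relation.Nullary using (¬_; Dec; yes; no)
open import Relation.Nullary.Decidable using (_×-dec_)

open import Defs

-- Algebra.Solver.Ring with integer coefficients, interpreted in R as n ·ₙ 1#.
module RingSolver {c ℓ} (R : CommutativeRing c ℓ) where
  open import Algebra.Solver.Ring.AlmostCommutativeRing using (fromCommutativeRing; _-Raw-AlmostCommutative⟶_)
  open import Data.Integer as ℤ using (ℤ; -[1+_]; sign; ∣_∣; _◃_; _⊖_)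
  import Data.Integer.Properties as ℤ
  open import Data.Maybe using (Maybe; map)
  open import Data.Nat as ℕ using (zero; suc)
  import Data.Nat.Properties as ℕ
  open import Data.Sign as Sign using (Sign)
  open import Relation.Binary.Consequences using (dec⇒weaklyDec)
  open CommutativeRing R
  open import Algebra.Properties.CommutativeSemigroup +-commutativeSemigroup using () renaming (interchange to +-interchange)
  open import Algebra.Properties.CommutativeSemigroup *-commutativeSemigroup using () renaming (interchange to *-interchange)
  open import Algebra.Properties.Ring ring using (-0#≈0#; -‿involutive; -1*x≈-x; -‿+-comm)
  open import Algebra.Properties.Semiring.Mult semiring using (×-homo-+; ×1-homo-*) renaming (_×_ to _·ₙ_)
  open import Relation.Binary.Reasoning.Setoid setoid

  ⟦_⟧ℤ : ℤ → Carrier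
  ⟦ + n ⟧ℤ = n ·ₙ 1#
  ⟦ -[1+ n ] ⟧ℤ = - (suc n ·ₙ 1#)

  ⟦_⟧ₛ : Sign → Carrier
  ⟦ Sign.+ ⟧ₛ = 1#
  ⟦ Sign.- ⟧ₛ = - 1#

  ⊖-homo : ∀ m n → ⟦ m ⊖ n ⟧ℤ ≈ m ·ₙ 1# - n ·ₙ 1#
  ⊖-homo zero zero = sym (trans (+-congˡ -0#≈0#) (+-identityʳ 0#))
  ⊖-homo zero (suc n) = sym (+-identityˡ _)
  ⊖-homo (suc m) zero = sym (trans (+-congˡ -0#≈0#) (+-identityʳ _))
  ⊖-homo (suc m) (suc n) rewrite ℤ.[1+m]⊖[1+n]≡m⊖n m n = begin
    ⟦ m ⊖ n ⟧ℤ                          ≈⟨ ⊖-homo m n ⟩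
    m′ - n′                             ≈⟨ +-identityˡ (m′ - n′) ⟨
    0# + (m′ - n′)                      ≈⟨ +-congʳ (-‿inverseʳ 1#) ⟨
    (1# - 1#) + (m′ - n′)               ≈⟨ +-interchange 1# (- 1#) m′ (- n′) ⟩
    (1# + m′) + (- 1# + - n′)           ≈⟨ +-congˡ (-‿+-comm 1# n′) ⟩
    (1# + m′) - (1# + n′)               ∎
    where
    m′ = m ·ₙ 1#
    n′ = n ·ₙ 1#

  +-homo : ∀ i j → ⟦ i ℤ.+ j ⟧ℤ ≈ ⟦ i ⟧ℤ + ⟦ j ⟧ℤ
  +-homo (+ m) (+ n) = ×-homo-+ 1# m n
  +-homo (+ m) -[1+ n ] = ⊖-homo m (suc n)
  +-homo -[1+ m ] (+ n) = trans (⊖-homo n (suc m)) (+-comm _ _)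
  +-homo -[1+ m ] -[1+ n ] = begin
    - (suc (suc (m ℕ.+ n)) ·ₙ 1#)       ≡⟨ ≡.cong (λ k → - (suc k ·ₙ 1#)) (ℕ.+-suc m n) ⟨
    - ((suc m ℕ.+ suc n) ·ₙ 1#)         ≈⟨ -‿cong (×-homo-+ 1# (suc m) (suc n)) ⟩
    - (suc m ·ₙ 1# + suc n ·ₙ 1#)       ≈⟨ -‿+-comm _ _ ⟨
    - (suc m ·ₙ 1#) + - (suc n ·ₙ 1#)   ∎

  -‿homo : ∀ i → ⟦ ℤ.- i ⟧ℤ ≈ - ⟦ i ⟧ℤ
  -‿homo (+ zero) = sym -0#≈0#
  -‿homo (+ suc n) = refl
  -‿homo -[1+ n ] = sym (-‿involutive _)

  ◃-homo : ∀ s n → ⟦ s ◃ n ⟧ℤ ≈ ⟦ s ⟧ₛ * n ·ₙ 1#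
  ◃-homo s zero = sym (zeroʳ _)
  ◃-homo Sign.+ (suc n) = sym (*-identityˡ _)
  ◃-homo Sign.- (suc n) = sym (-1*x≈-x _)

  sign-homo : ∀ s t → ⟦ s Sign.* t ⟧ₛ ≈ ⟦ s ⟧ₛ * ⟦ t ⟧ₛ
  sign-homo Sign.+ t = sym (*-identityˡ _)
  sign-homo Sign.- Sign.+ = sym (*-identityʳ _)
  sign-homo Sign.- Sign.- = sym (trans (-1*x≈-x _) (-‿involutive _))

  sign-abs : ∀ i → ⟦ i ⟧ℤ ≈ ⟦ sign i ⟧ₛ * ∣ i ∣ ·ₙ 1#
  sign-abs i = ≡.subst (λ k → ⟦ k ⟧ℤ ≈ ⟦ sign i ⟧ₛ * ∣ i ∣ ·ₙ 1#) (ℤ.◃-inverse i) (◃-homo (sign i) ∣ i ∣)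

  *-homo : ∀ i j → ⟦ i ℤ.* j ⟧ℤ ≈ ⟦ i ⟧ℤ * ⟦ j ⟧ℤ
  *-homo i j = begin
    ⟦ sign i Sign.* sign j ◃ ∣ i ∣ ℕ.* ∣ j ∣ ⟧ℤ
      ≈⟨ ◃-homo (sign i Sign.* sign j) (∣ i ∣ ℕ.* ∣ j ∣) ⟩
    ⟦ sign i Sign.* sign j ⟧ₛ * (∣ i ∣ ℕ.* ∣ j ∣) ·ₙ 1#
      ≈⟨ *-cong (sign-homo (sign i) (sign j)) (×1-homo-* ∣ i ∣ ∣ j ∣) ⟩
    (⟦ sign i ⟧ₛ * ⟦ sign j ⟧ₛ) * (∣ i ∣ ·ₙ 1# * ∣ j ∣ ·ₙ 1#)
      ≈⟨ *-interchange _ _ _ _ ⟩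
    (⟦ sign i ⟧ₛ * ∣ i ∣ ·ₙ 1#) * (⟦ sign j ⟧ₛ * ∣ j ∣ ·ₙ 1#)
      ≈⟨ *-cong (sign-abs i) (sign-abs j) ⟨
    ⟦ i ⟧ℤ * ⟦ j ⟧ℤ
      ∎

  homomorphism : ℤ.+-*-rawRing -Raw-AlmostCommutative⟶ fromCommutativeRing R
  homomorphism = record
    { ⟦_⟧ = ⟦_⟧ℤ ; +-homo = +-homo ; *-homo = *-homo ; -‿homo = -‿homo
    ; 0-homo = refl ; 1-homo = +-identityʳ 1# }

  weakly-decide : ∀ i j → Maybe (⟦ i ⟧ℤ ≈ ⟦ j ⟧ℤ)
  weakly-decide i j = map (λ { ≡.refl → refl }) (dec⇒weaklyDec ℤ._≟_ i j)

  open import Algebra.Solver.Ring ℤ.+-*-rawRing (fromCommutativeRing R) homomorphism weakly-decide public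

-- Instantiated both for field elements and for solver polynomials, so that an identity
-- between coordinate vectors is stated to the solver with the same operators.
module TripleOperations {a} {A : Set a} (_+_ _*_ : A → A → A) (-_ : A → A) where

  infix  5 _·_
  infixl 6 _⊕_ _⊝_
  infix  7 _⨯_
  infixr 8 _•_

  _·_ : A × A × A → A × A × A → A
  (a₀ , a₁ , a₂) · (b₀ , b₁ , b₂) = ((a₀ * b₀) + (a₁ * b₁)) + (a₂ * b₂)

  _⨯_ : A × A × A → A × A × A → A × A × A
  (a₀ , a₁ , a₂) ⨯ (b₀ , b₁ , b₂) =
    (a₁ * b₂) + (- (a₂ * b₁)) , (a₂ * b₀) + (- (a₀ * b₂)) , (a₀ * b₁) + (- (a₁ * b₀))

  _•_ : A → A × A × A → A × A × A
  k • (a₀ , a₁ , a₂) = k * a₀ , k * a₁ , k * a₂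

  _⊕_ _⊝_ : A × A × A → A × A × A → A × A × A
  (a₀ , a₁ , a₂) ⊕ (b₀ , b₁ , b₂) = a₀ + b₀ , a₁ + b₁ , a₂ + b₂
  (a₀ , a₁ , a₂) ⊝ (b₀ , b₁ , b₂) = a₀ + (- b₀) , a₁ + (- b₁) , a₂ + (- b₂)

module ProjectivePlane {c ℓ} (F : CommutativeRing c ℓ) (isField : IsField F)
  (_≟_ : Decidable (CommutativeRing._≈_ F)) where

  open CommutativeRing F
  open import Algebra.Properties.Ring ring using (x∙y⁻¹≈ε⇒x≈y; x≈y⇒x∙y⁻¹≈ε)
  open RingSolver F using (solve; _:=_; Polynomial; _:+_; _:*_; _:-_; :-_; con)
  open TripleOperations _+_ _*_ -_ public
  private module P {n} = TripleOperations {A = Polynomial n} _:+_ _:*_ :-_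

  module ≈-Reasoning = Relation.Binary.Reasoning.Setoid setoid

  1≉0 : 1# ≉ 0#
  1≉0 = proj₁ isField

  inverse : ∀ x → x ≉ 0# → Carrier
  inverse x x≉0 = proj₁ (proj₂ isField x x≉0)

  *-inverseʳ : ∀ x (x≉0 : x ≉ 0#) → x * inverse x x≉0 ≈ 1#
  *-inverseʳ x x≉0 = proj₂ (proj₂ isField x x≉0)

  *-inverseˡ : ∀ x (x≉0 : x ≉ 0#) → inverse x x≉0 * x ≈ 1#
  *-inverseˡ x x≉0 = trans (*-comm _ x) (*-inverseʳ x x≉0)

  x*y≈0⇒y≈0 : ∀ {x y} → x ≉ 0# → x * y ≈ 0# → y ≈ 0#
  x*y≈0⇒y≈0 {x} {y} x≉0 xy≈0 = begin
    y                        ≈⟨ *-identityˡ y ⟨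
    1# * y                   ≈⟨ *-congʳ (*-inverseˡ x x≉0) ⟨
    (inverse x x≉0 * x) * y  ≈⟨ *-assoc _ x y ⟩
    inverse x x≉0 * (x * y)  ≈⟨ *-congˡ xy≈0 ⟩
    inverse x x≉0 * 0#       ≈⟨ zeroʳ _ ⟩
    0#                       ∎
    where open ≈-Reasoning

  *-≉0 : ∀ {x y} → x ≉ 0# → y ≉ 0# → x * y ≉ 0#
  *-≉0 x≉0 y≉0 xy≈0 = y≉0 (x*y≈0⇒y≈0 x≉0 xy≈0)

  inverse-≉0 : ∀ x (x≉0 : x ≉ 0#) → inverse x x≉0 ≉ 0#
  inverse-≉0 x x≉0 x⁻¹≈0 = 1≉0 (trans (sym (*-inverseʳ x x≉0)) (trans (*-congˡ x⁻¹≈0) (zeroʳ x)))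

  normalise : ∀ {k a b m l x} (k≉0 : k ≉ 0#) (b≉0 : b ≉ 0#) → k * m ≈ a * l + b * x →
              m ≈ (inverse k k≉0 * b) * ((inverse b b≉0 * a) * l + x)
  normalise {k} {a} {b} {m} {l} {x} k≉0 b≉0 km≈al+bx = sym (begin
    (k⁻¹ * b) * ((b⁻¹ * a) * l + x)     ≈⟨ solve 6 (λ k⁻¹ b b⁻¹ a l x →
                                             (k⁻¹ :* b) :* ((b⁻¹ :* a) :* l :+ x)
                                             := k⁻¹ :* ((b :* b⁻¹) :* (a :* l) :+ b :* x))
                                             refl k⁻¹ b b⁻¹ a l x ⟩
    k⁻¹ * ((b * b⁻¹) * (a * l) + b * x) ≈⟨ *-congˡ (+-congʳ (trans (*-congʳ (*-inverseʳ b b≉0)) (*-identityˡ _))) ⟩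
    k⁻¹ * (a * l + b * x)               ≈⟨ *-congˡ km≈al+bx ⟨
    k⁻¹ * (k * m)                       ≈⟨ *-assoc k⁻¹ k m ⟨
    (k⁻¹ * k) * m                       ≈⟨ trans (*-congʳ (*-inverseˡ k k≉0)) (*-identityˡ m) ⟩
    m                                   ∎)
    where
    open ≈-Reasoning
    k⁻¹ = inverse k k≉0
    b⁻¹ = inverse b b≉0

  Triple : Set c
  Triple = Carrier × Carrier × Carrier

  ≐-setoid : Setoid c ℓ
  ≐-setoid = ×-setoid setoid (×-setoid setoid setoid)

  open Setoid ≐-setoid public using () renaming (_≈_ to _≐_; sym to ≐-sym; trans to ≐-trans)

  module ≐-Reasoning = Relation.Binary.Reasoning.Setoid ≐-setoid

  coords : Vec3 F → Triple
  coords v = x₀ v , x₁ v , x₂ v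

  𝟎 : Triple
  𝟎 = 0# , 0# , 0#

  ·-comm : ∀ u v → u · v ≈ v · u
  ·-comm (a₀ , a₁ , a₂) (b₀ , b₁ , b₂) =
    solve 6 (λ a₀ a₁ a₂ b₀ b₁ b₂ → (a₀ , a₁ , a₂) P.· (b₀ , b₁ , b₂) := (b₀ , b₁ , b₂) P.· (a₀ , a₁ , a₂))
      refl a₀ a₁ a₂ b₀ b₁ b₂

  ·-congʳ : ∀ u {v w} → v ≐ w → u · v ≈ u · w
  ·-congʳ u (e₀ , e₁ , e₂) = +-cong (+-cong (*-congˡ e₀) (*-congˡ e₁)) (*-congˡ e₂)

  ·-congˡ : ∀ {u v} w → u ≐ v → u · w ≈ v · w
  ·-congˡ {u} {v} w u≐v = trans (·-comm u w) (trans (·-congʳ w u≐v) (·-comm w v))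

  ·-•ʳ : ∀ u k v → u · k • v ≈ k * (u · v)
  ·-•ʳ (a₀ , a₁ , a₂) k (b₀ , b₁ , b₂) =
    solve 7 (λ a₀ a₁ a₂ k b₀ b₁ b₂ → (a₀ , a₁ , a₂) P.· k P.• (b₀ , b₁ , b₂) := k :* ((a₀ , a₁ , a₂) P.· (b₀ , b₁ , b₂)))
      refl a₀ a₁ a₂ k b₀ b₁ b₂

  ·-•ˡ : ∀ k u v → k • u · v ≈ k * (u · v)
  ·-•ˡ k u v = trans (·-comm (k • u) v) (trans (·-•ʳ v k u) (*-congˡ (·-comm v u)))

  ·-⊕ʳ : ∀ u v w → u · v ⊕ w ≈ (u · v) + (u · w)
  ·-⊕ʳ (a₀ , a₁ , a₂) (b₀ , b₁ , b₂) (c₀ , c₁ , c₂) =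
    solve 9 (λ a₀ a₁ a₂ b₀ b₁ b₂ c₀ c₁ c₂ → let u = a₀ , a₁ , a₂ ; v = b₀ , b₁ , b₂ ; w = c₀ , c₁ , c₂ in
      u P.· v P.⊕ w := (u P.· v) :+ (u P.· w))
      refl a₀ a₁ a₂ b₀ b₁ b₂ c₀ c₁ c₂

  ·-⊝ʳ : ∀ u v w → u · v ⊝ w ≈ (u · v) - (u · w)
  ·-⊝ʳ (a₀ , a₁ , a₂) (b₀ , b₁ , b₂) (c₀ , c₁ , c₂) =
    solve 9 (λ a₀ a₁ a₂ b₀ b₁ b₂ c₀ c₁ c₂ → let u = a₀ , a₁ , a₂ ; v = b₀ , b₁ , b₂ ; w = c₀ , c₁ , c₂ in
      u P.· v P.⊝ w := (u P.· v) :+ :- (u P.· w))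
      refl a₀ a₁ a₂ b₀ b₁ b₂ c₀ c₁ c₂

  ⨯-·ˡ : ∀ u v → u ⨯ v · u ≈ 0#
  ⨯-·ˡ (a₀ , a₁ , a₂) (b₀ , b₁ , b₂) =
    solve 6 (λ a₀ a₁ a₂ b₀ b₁ b₂ → let u = a₀ , a₁ , a₂ ; v = b₀ , b₁ , b₂ in u P.⨯ v P.· u := con (+ 0))
      refl a₀ a₁ a₂ b₀ b₁ b₂

  ⨯-·ʳ : ∀ u v → u ⨯ v · v ≈ 0#
  ⨯-·ʳ (a₀ , a₁ , a₂) (b₀ , b₁ , b₂) =
    solve 6 (λ a₀ a₁ a₂ b₀ b₁ b₂ → let u = a₀ , a₁ , a₂ ; v = b₀ , b₁ , b₂ in u P.⨯ v P.· v := con (+ 0))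
      refl a₀ a₁ a₂ b₀ b₁ b₂

  ⨯-⨯ : ∀ w u v → w ⨯ (u ⨯ v) ≐ (w · v) • u ⊝ (w · u) • v
  ⨯-⨯ (c₀ , c₁ , c₂) (a₀ , a₁ , a₂) (b₀ , b₁ , b₂) =
      solve 9 (λ c₀ c₁ c₂ a₀ a₁ a₂ b₀ b₁ b₂ → let w = c₀ , c₁ , c₂ ; u = a₀ , a₁ , a₂ ; v = b₀ , b₁ , b₂ in
        proj₁ (w P.⨯ (u P.⨯ v)) := proj₁ ((w P.· v) P.• u P.⊝ (w P.· u) P.• v))
        refl c₀ c₁ c₂ a₀ a₁ a₂ b₀ b₁ b₂
    , solve 9 (λ c₀ c₁ c₂ a₀ a₁ a₂ b₀ b₁ b₂ → let w = c₀ , c₁ , c₂ ; u = a₀ , a₁ , a₂ ; v = b₀ , b₁ , b₂ in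
        proj₁ (proj₂ (w P.⨯ (u P.⨯ v))) := proj₁ (proj₂ ((w P.· v) P.• u P.⊝ (w P.· u) P.• v)))
        refl c₀ c₁ c₂ a₀ a₁ a₂ b₀ b₁ b₂
    , solve 9 (λ c₀ c₁ c₂ a₀ a₁ a₂ b₀ b₁ b₂ → let w = c₀ , c₁ , c₂ ; u = a₀ , a₁ , a₂ ; v = b₀ , b₁ , b₂ in
        proj₂ (proj₂ (w P.⨯ (u P.⨯ v))) := proj₂ (proj₂ ((w P.· v) P.• u P.⊝ (w P.· u) P.• v)))
        refl c₀ c₁ c₂ a₀ a₁ a₂ b₀ b₁ b₂

  cramer : ∀ e L M n → (e · L ⨯ n) • M ≐ (e · M ⨯ n) • L ⊕ (e · L ⨯ M) • n ⊕ (L ⨯ n · M) • e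
  cramer (e₀ , e₁ , e₂) (l₀ , l₁ , l₂) (m₀ , m₁ , m₂) (n₀ , n₁ , n₂) =
      solve 12 (λ e₀ e₁ e₂ l₀ l₁ l₂ m₀ m₁ m₂ n₀ n₁ n₂ →
        let e = e₀ , e₁ , e₂ ; L = l₀ , l₁ , l₂ ; M = m₀ , m₁ , m₂ ; n = n₀ , n₁ , n₂ in
        proj₁ ((e P.· L P.⨯ n) P.• M) := proj₁ ((e P.· M P.⨯ n) P.• L P.⊕ (e P.· L P.⨯ M) P.• n P.⊕ (L P.⨯ n P.· M) P.• e))
        refl e₀ e₁ e₂ l₀ l₁ l₂ m₀ m₁ m₂ n₀ n₁ n₂
    , solve 12 (λ e₀ e₁ e₂ l₀ l₁ l₂ m₀ m₁ m₂ n₀ n₁ n₂ →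
        let e = e₀ , e₁ , e₂ ; L = l₀ , l₁ , l₂ ; M = m₀ , m₁ , m₂ ; n = n₀ , n₁ , n₂ in
        proj₁ (proj₂ ((e P.· L P.⨯ n) P.• M))
        := proj₁ (proj₂ ((e P.· M P.⨯ n) P.• L P.⊕ (e P.· L P.⨯ M) P.• n P.⊕ (L P.⨯ n P.· M) P.• e)))
        refl e₀ e₁ e₂ l₀ l₁ l₂ m₀ m₁ m₂ n₀ n₁ n₂
    , solve 12 (λ e₀ e₁ e₂ l₀ l₁ l₂ m₀ m₁ m₂ n₀ n₁ n₂ →
        let e = e₀ , e₁ , e₂ ; L = l₀ , l₁ , l₂ ; M = m₀ , m₁ , m₂ ; n = n₀ , n₁ , n₂ in
        proj₂ (proj₂ ((e P.· L P.⨯ n) P.• M))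
        := proj₂ (proj₂ ((e P.· M P.⨯ n) P.• L P.⊕ (e P.· L P.⨯ M) P.• n P.⊕ (L P.⨯ n P.· M) P.• e)))
        refl e₀ e₁ e₂ l₀ l₁ l₂ m₀ m₁ m₂ n₀ n₁ n₂

  •-congˡ : ∀ k {u v} → u ≐ v → k • u ≐ k • v
  •-congˡ k (e₀ , e₁ , e₂) = *-congˡ e₀ , *-congˡ e₁ , *-congˡ e₂

  •-congʳ : ∀ {k k′} u → k ≈ k′ → k • u ≐ k′ • u
  •-congʳ (a₀ , a₁ , a₂) k≈k′ = *-congʳ k≈k′ , *-congʳ k≈k′ , *-congʳ k≈k′

  •-assoc : ∀ k k′ u → k • k′ • u ≐ (k * k′) • u
  •-assoc k k′ (a₀ , a₁ , a₂) = sym (*-assoc k k′ a₀) , sym (*-assoc k k′ a₁) , sym (*-assoc k k′ a₂)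

  •-identity : ∀ u → 1# • u ≐ u
  •-identity (a₀ , a₁ , a₂) = *-identityˡ a₀ , *-identityˡ a₁ , *-identityˡ a₂

  •-zero : ∀ {k} u → k ≈ 0# → k • u ≐ 𝟎
  •-zero {k} (a₀ , a₁ , a₂) k≈0 = z a₀ , z a₁ , z a₂
    where
    z : ∀ a → k * a ≈ 0#
    z a = trans (*-congʳ k≈0) (zeroˡ a)

  •-divide : ∀ {k u w} (k≉0 : k ≉ 0#) → k • u ≐ w → u ≐ inverse k k≉0 • w
  •-divide {k} {u} {w} k≉0 ku≐w = begin
    u                 ≈⟨ •-identity u ⟨
    1# • u            ≈⟨ •-congʳ u (*-inverseˡ k k≉0) ⟨
    (k⁻¹ * k) • u     ≈⟨ •-assoc k⁻¹ k u ⟨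
    k⁻¹ • k • u       ≈⟨ •-congˡ k⁻¹ ku≐w ⟩
    k⁻¹ • w           ∎
    where
    open ≐-Reasoning
    k⁻¹ = inverse k k≉0

  ⊝≐𝟎⇒≐ : ∀ {u v} → u ⊝ v ≐ 𝟎 → u ≐ v
  ⊝≐𝟎⇒≐ (e₀ , e₁ , e₂) = x∙y⁻¹≈ε⇒x≈y _ _ e₀ , x∙y⁻¹≈ε⇒x≈y _ _ e₁ , x∙y⁻¹≈ε⇒x≈y _ _ e₂

  ⊝-𝟎 : ∀ {u v} → u ≐ 𝟎 → v ≐ 𝟎 → u ⊝ v ≐ 𝟎
  ⊝-𝟎 (a₀ , a₁ , a₂) (b₀ , b₁ , b₂) = z a₀ b₀ , z a₁ b₁ , z a₂ b₂
    where
    z : ∀ {x y} → x ≈ 0# → y ≈ 0# → x - y ≈ 0#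
    z x≈0 y≈0 = trans (+-cong x≈0 (-‿cong y≈0)) (-‿inverseʳ 0#)

  ⨯-zeroʳ : ∀ u {w} → w ≐ 𝟎 → u ⨯ w ≐ 𝟎
  ⨯-zeroʳ (a₀ , a₁ , a₂) (b₀ , b₁ , b₂) = z a₁ a₂ b₂ b₁ , z a₂ a₀ b₀ b₂ , z a₀ a₁ b₁ b₀
    where
    z : ∀ a a′ {b b′} → b ≈ 0# → b′ ≈ 0# → a * b - a′ * b′ ≈ 0#
    z a a′ b≈0 b′≈0 = trans (+-cong (*-congˡ b≈0) (-‿cong (*-congˡ b′≈0)))
      (solve 2 (λ a a′ → a :* con (+ 0) :- a′ :* con (+ 0) := con (+ 0)) refl a a′)

  ⊕-𝟎ʳ : ∀ u {v} → v ≐ 𝟎 → u ⊕ v ≐ u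
  ⊕-𝟎ʳ (a₀ , a₁ , a₂) (b₀ , b₁ , b₂) = z b₀ , z b₁ , z b₂
    where
    z : ∀ {a b} → b ≈ 0# → a + b ≈ a
    z b≈0 = trans (+-congˡ b≈0) (+-identityʳ _)

  -- Records rather than the reducible _∼_ F and _I_ F of Defs, so that the points and lines
  -- involved can be inferred from a proof of proportionality or incidence.
  record _≃_ (u v : Vec3 F) : Set (c ⊔ ℓ) where
    constructor proportional
    field
      {factor} : Carrier
      factor≉0 : factor ≉ 0#
      coords≐ : coords u ≐ factor • coords v

  record _∈_ (p l : Vec3 F) : Set ℓ where
    constructor incident
    field
      ·≈0 : coords p · coords l ≈ 0#

  infix 4 _≃_ _≄_ _∈_

  _≄_ : Vec3 F → Vec3 F → Set (c ⊔ ℓ)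
  u ≄ v = ¬ u ≃ v

  ∼⇒≃ : ∀ {u v} → _∼_ F u v → u ≃ v
  ∼⇒≃ (k , k≉0 , u≐kv) = proportional k≉0 u≐kv

  ≃⇒∼ : ∀ {u v} → u ≃ v → _∼_ F u v
  ≃⇒∼ (proportional k≉0 u≐kv) = _ , k≉0 , u≐kv

  ¬∼⇒≄ : ∀ {u v} → ¬ _∼_ F u v → u ≄ v
  ¬∼⇒≄ u≁v u≃v = u≁v (≃⇒∼ u≃v)

  ≄⇒¬∼ : ∀ {u v} → u ≄ v → ¬ _∼_ F u v
  ≄⇒¬∼ u≄v u∼v = u≄v (∼⇒≃ u∼v)

  ≃-refl : ∀ {u} → u ≃ u
  ≃-refl {u} = proportional 1≉0 (≐-sym (•-identity (coords u)))

  ≃-sym : ∀ {u v} → u ≃ v → v ≃ u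
  ≃-sym (proportional k≉0 u≐kv) = proportional (inverse-≉0 _ k≉0) (•-divide k≉0 (≐-sym u≐kv))

  ≃-trans : ∀ {u v w} → u ≃ v → v ≃ w → u ≃ w
  ≃-trans {w = w} (proportional {k} k≉0 u≐kv) (proportional {k′} k′≉0 v≐k′w) =
    proportional (*-≉0 k≉0 k′≉0) (≐-trans u≐kv (≐-trans (•-congˡ k v≐k′w) (•-assoc k k′ (coords w))))

  ≄-sym : ∀ {u v} → u ≄ v → v ≄ u
  ≄-sym u≄v v≃u = u≄v (≃-sym v≃u)

  ≃-setoid : Setoid (c ⊔ ℓ) (c ⊔ ℓ)
  ≃-setoid = record
    { Carrier = Vec3 F
    ; _≈_ = _≃_
    ; isEquivalence = record { refl = ≃-refl ; sym = ≃-sym ; trans = ≃-trans }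
    }

  module ≃-Reasoning = Relation.Binary.Reasoning.Setoid ≃-setoid

  ∈-respˡ : ∀ {p p′ l} → p ≃ p′ → p ∈ l → p′ ∈ l
  ∈-respˡ {p} {p′} {l} (proportional {k} k≉0 p≐kp′) (incident p·l≈0) = incident (x*y≈0⇒y≈0 k≉0 (begin
    k * (coords p′ · coords l)   ≈⟨ ·-•ˡ k (coords p′) (coords l) ⟨
    k • coords p′ · coords l     ≈⟨ ·-congˡ (coords l) p≐kp′ ⟨
    coords p · coords l          ≈⟨ p·l≈0 ⟩
    0#                           ∎))
    where open ≈-Reasoning

  ∈-respʳ : ∀ {p l l′} → l ≃ l′ → p ∈ l → p ∈ l′
  ∈-respʳ {p} {l} {l′} (proportional {k} k≉0 l≐kl′) (incident p·l≈0) = incident (x*y≈0⇒y≈0 k≉0 (begin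
    k * (coords p · coords l′)   ≈⟨ ·-•ʳ (coords p) k (coords l′) ⟨
    coords p · k • coords l′     ≈⟨ ·-congʳ (coords p) l≐kl′ ⟨
    coords p · coords l          ≈⟨ p·l≈0 ⟩
    0#                           ∎))
    where open ≈-Reasoning

  ∈-sym : ∀ {p l} → p ∈ l → l ∈ p
  ∈-sym {p} {l} (incident p·l≈0) = incident (trans (·-comm (coords l) (coords p)) p·l≈0)

  nonzero-coordinate : ∀ {a₀ a₁ a₂} → ¬ (a₀ , a₁ , a₂) ≐ 𝟎 → a₀ ≉ 0# ⊎ a₁ ≉ 0# ⊎ a₂ ≉ 0#
  nonzero-coordinate {a₀} {a₁} {a₂} t≉𝟎 with a₀ ≟ 0# | a₁ ≟ 0# | a₂ ≟ 0#
  ... | no a₀≉0  | _        | _        = inj₁ a₀≉0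
  ... | yes _    | no a₁≉0  | _        = inj₂ (inj₁ a₁≉0)
  ... | yes _    | yes _    | no a₂≉0  = inj₂ (inj₂ a₂≉0)
  ... | yes a₀≈0 | yes a₁≈0 | yes a₂≈0 = ⊥-elim (t≉𝟎 (a₀≈0 , a₁≈0 , a₂≈0))

  ∃-non-orthogonal : ∀ t → ¬ t ≐ 𝟎 → ∃ λ e → e · t ≉ 0#
  ∃-non-orthogonal (a₀ , a₁ , a₂) t≉𝟎 with nonzero-coordinate t≉𝟎
  ... | inj₁ a₀≉0 = (a₀ , 0# , 0#) , λ e·t≈0 → *-≉0 a₀≉0 a₀≉0 (trans (sym
          (solve 3 (λ a₀ a₁ a₂ → (a₀ :* a₀ :+ con (+ 0) :* a₁) :+ con (+ 0) :* a₂ := a₀ :* a₀) refl a₀ a₁ a₂)) e·t≈0)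
  ... | inj₂ (inj₁ a₁≉0) = (0# , a₁ , 0#) , λ e·t≈0 → *-≉0 a₁≉0 a₁≉0 (trans (sym
          (solve 3 (λ a₀ a₁ a₂ → (con (+ 0) :* a₀ :+ a₁ :* a₁) :+ con (+ 0) :* a₂ := a₁ :* a₁) refl a₀ a₁ a₂)) e·t≈0)
  ... | inj₂ (inj₂ a₂≉0) = (0# , 0# , a₂) , λ e·t≈0 → *-≉0 a₂≉0 a₂≉0 (trans (sym
          (solve 3 (λ a₀ a₁ a₂ → (con (+ 0) :* a₀ :+ con (+ 0) :* a₁) :+ a₂ :* a₂ := a₂ :* a₂) refl a₀ a₁ a₂)) e·t≈0)

  ≐•⇒≃ : ∀ u v {k} → coords u ≐ k • coords v → u ≃ v
  ≐•⇒≃ u v u≐kv = proportional (λ k≈0 → nonzero u (≐-trans u≐kv (•-zero (coords v) k≈0))) u≐kv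

  ⨯≐𝟎⇒≃ : ∀ u v → coords u ⨯ coords v ≐ 𝟎 → u ≃ v
  ⨯≐𝟎⇒≃ u v u⨯v≐𝟎 with ∃-non-orthogonal (coords v) (nonzero v)
  ... | e , e·v≉0 = ≐•⇒≃ u v (begin
    coords u                                                  ≈⟨ •-divide e·v≉0 (⊝≐𝟎⇒≐ (begin
      (e · coords v) • coords u ⊝ (e · coords u) • coords v     ≈⟨ ⨯-⨯ e (coords u) (coords v) ⟨
      e ⨯ (coords u ⨯ coords v)                                 ≈⟨ ⨯-zeroʳ e u⨯v≐𝟎 ⟩
      𝟎                                                         ∎)) ⟩
    inverse (e · coords v) e·v≉0 • (e · coords u) • coords v  ≈⟨ •-assoc _ _ (coords v) ⟩
    (inverse (e · coords v) e·v≉0 * (e · coords u)) • coords v ∎)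
    where open ≐-Reasoning

  vec3 : (t : Triple) → ¬ t ≐ 𝟎 → Vec3 F
  vec3 (a₀ , a₁ , a₂) t≉𝟎 = ⟨ a₀ , a₁ , a₂ ⟩∶ t≉𝟎

  cross : ∀ u v → u ≄ v → Vec3 F
  cross u v u≄v = vec3 (coords u ⨯ coords v) (λ u⨯v≐𝟎 → u≄v (⨯≐𝟎⇒≃ u v u⨯v≐𝟎))

  ≃-cross : ∀ {u v w} (u≄v : u ≄ v) → u ∈ w → v ∈ w → w ≃ cross u v u≄v
  ≃-cross {u} {v} {w} u≄v u∈w v∈w = ⨯≐𝟎⇒≃ w (cross u v u≄v) (begin
    coords w ⨯ (coords u ⨯ coords v)                                    ≈⟨ ⨯-⨯ (coords w) (coords u) (coords v) ⟩
    (coords w · coords v) • coords u ⊝ (coords w · coords u) • coords v ≈⟨ ⊝-𝟎 (w·≈0 v∈w (coords u)) (w·≈0 u∈w (coords v)) ⟩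
    𝟎                                                                   ∎)
    where
    open ≐-Reasoning
    w·≈0 : ∀ {x} → x ∈ w → ∀ t → (coords w · coords x) • t ≐ 𝟎
    w·≈0 x∈w t = •-zero t (_∈_.·≈0 (∈-sym x∈w))

  join-unique : ∀ {p r l l′} → p ≄ r → p ∈ l → r ∈ l → p ∈ l′ → r ∈ l′ → l ≃ l′
  join-unique {p} {r} {l} {l′} p≄r p∈l r∈l p∈l′ r∈l′ = begin
    l               ≈⟨ ≃-cross p≄r p∈l r∈l ⟩
    cross p r p≄r   ≈⟨ ≃-cross p≄r p∈l′ r∈l′ ⟨
    l′              ∎
    where open ≃-Reasoning

  meet-unique : ∀ {l l′ p r} → l ≄ l′ → p ∈ l → p ∈ l′ → r ∈ l → r ∈ l′ → p ≃ r
  meet-unique l≄l′ p∈l p∈l′ r∈l r∈l′ = join-unique l≄l′ (∈-sym p∈l) (∈-sym p∈l′) (∈-sym r∈l) (∈-sym r∈l′)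

  ≐𝟎? : ∀ t → Dec (t ≐ 𝟎)
  ≐𝟎? (a₀ , a₁ , a₂) = (a₀ ≟ 0#) ×-dec ((a₁ ≟ 0#) ×-dec (a₂ ≟ 0#))

  twoPointsOn : ∀ l → ∃₂ λ p r → p ≄ r × p ∈ l × r ∈ l
  twoPointsOn l@(⟨ l₀ , l₁ , l₂ ⟩∶ _) with nonzero-coordinate (nonzero l)
  ... | inj₁ l₀≉0 =
    ⟨ - l₁ , l₀ , 0# ⟩∶ (λ (_ , l₀≈0 , _) → l₀≉0 l₀≈0) ,
    ⟨ - l₂ , 0# , l₀ ⟩∶ (λ (_ , _ , l₀≈0) → l₀≉0 l₀≈0) ,
    (λ (proportional k≉0 (_ , _ , 0≈kl₀)) → *-≉0 k≉0 l₀≉0 (sym 0≈kl₀)) ,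
    incident (solve 3 (λ l₀ l₁ l₂ → ((:- l₁) :* l₀ :+ l₀ :* l₁) :+ con (+ 0) :* l₂ := con (+ 0)) refl l₀ l₁ l₂) ,
    incident (solve 3 (λ l₀ l₁ l₂ → ((:- l₂) :* l₀ :+ con (+ 0) :* l₁) :+ l₀ :* l₂ := con (+ 0)) refl l₀ l₁ l₂)
  ... | inj₂ (inj₁ l₁≉0) =
    ⟨ l₁ , - l₀ , 0# ⟩∶ (λ (l₁≈0 , _ , _) → l₁≉0 l₁≈0) ,
    ⟨ 0# , - l₂ , l₁ ⟩∶ (λ (_ , _ , l₁≈0) → l₁≉0 l₁≈0) ,
    (λ (proportional {k} _ (l₁≈k0 , _ , _)) → l₁≉0 (trans l₁≈k0 (zeroʳ k))) ,
    incident (solve 3 (λ l₀ l₁ l₂ → (l₁ :* l₀ :+ (:- l₀) :* l₁) :+ con (+ 0) :* l₂ := con (+ 0)) refl l₀ l₁ l₂) ,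
    incident (solve 3 (λ l₀ l₁ l₂ → (con (+ 0) :* l₀ :+ (:- l₂) :* l₁) :+ l₁ :* l₂ := con (+ 0)) refl l₀ l₁ l₂)
  ... | inj₂ (inj₂ l₂≉0) =
    ⟨ l₂ , 0# , - l₀ ⟩∶ (λ (l₂≈0 , _ , _) → l₂≉0 l₂≈0) ,
    ⟨ 0# , l₂ , - l₁ ⟩∶ (λ (_ , l₂≈0 , _) → l₂≉0 l₂≈0) ,
    (λ (proportional {k} _ (l₂≈k0 , _ , _)) → l₂≉0 (trans l₂≈k0 (zeroʳ k))) ,
    incident (solve 3 (λ l₀ l₁ l₂ → (l₂ :* l₀ :+ con (+ 0) :* l₁) :+ (:- l₀) :* l₂ := con (+ 0)) refl l₀ l₁ l₂) ,
    incident (solve 3 (λ l₀ l₁ l₂ → (con (+ 0) :* l₀ :+ l₂ :* l₁) :+ (:- l₁) :* l₂ := con (+ 0)) refl l₀ l₁ l₂)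

  meet : ∀ u v → ∃ λ p → p ∈ u × p ∈ v
  meet u v with ≐𝟎? (coords u ⨯ coords v)
  ... | yes u⨯v≐𝟎 = let p , _ , _ , p∈u , _ = twoPointsOn u in p , p∈u , ∈-respʳ (⨯≐𝟎⇒≃ u v u⨯v≐𝟎) p∈u
  ... | no u⨯v≉𝟎 = vec3 _ u⨯v≉𝟎 , incident (⨯-·ˡ (coords u) (coords v)) , incident (⨯-·ʳ (coords u) (coords v))

  -- Pencils and Desargues' theorem

  record InPencil (L n M : Vec3 F) : Set (c ⊔ ℓ) where
    field
      {ν κ} : Carrier
      κ≉0 : κ ≉ 0#
      coords≐ : coords M ≐ κ • (ν • coords L ⊕ coords n)

  concurrent⇒span : ∀ {X L M n} → X ∈ L → X ∈ M → X ∈ n → (L≄n : L ≄ n) → ∀ e →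
    (e · coords L ⨯ coords n) • coords M ≐ (e · coords M ⨯ coords n) • coords L ⊕ (e · coords L ⨯ coords M) • coords n
  concurrent⇒span {X} {L} {M} {n} X∈L X∈M X∈n L≄n e =
    ≐-trans (cramer e (coords L) (coords M) (coords n)) (⊕-𝟎ʳ _ (•-zero e (_∈_.·≈0 L⨯n∈M)))
    where
    L⨯n∈M : cross L n L≄n ∈ M
    L⨯n∈M = ∈-respˡ (≃-cross L≄n (∈-sym X∈L) (∈-sym X∈n)) X∈M

  span⇒InPencil : ∀ {k a b L M n} → k ≉ 0# → M ≄ L → k • coords M ≐ a • coords L ⊕ b • coords n → InPencil L n M
  span⇒InPencil {k} {a} {b} {L} {M} {n} k≉0 M≄L kM≐aL+bn = record
    { κ≉0 = *-≉0 (inverse-≉0 k k≉0) b≉0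
    ; coords≐ = let h₀ , h₁ , h₂ = kM≐aL+bn in normalise k≉0 b≉0 h₀ , normalise k≉0 b≉0 h₁ , normalise k≉0 b≉0 h₂
    }
    where
    b≉0 : b ≉ 0#
    b≉0 b≈0 = M≄L (≐•⇒≃ M L (begin
      coords M                         ≈⟨ •-divide k≉0 (≐-trans kM≐aL+bn (⊕-𝟎ʳ _ (•-zero (coords n) b≈0))) ⟩
      inverse k k≉0 • a • coords L     ≈⟨ •-assoc _ a (coords L) ⟩
      (inverse k k≉0 * a) • coords L   ∎))
      where open ≐-Reasoning

  inPencil : ∀ {X L M n} → X ∈ L → X ∈ M → X ∈ n → L ≄ n → M ≄ L → InPencil L n M
  inPencil {L = L} {n = n} X∈L X∈M X∈n L≄n M≄L =
    let e , e·L⨯n≉0 = ∃-non-orthogonal (coords L ⨯ coords n) (nonzero (cross L n L≄n))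
    in span⇒InPencil e·L⨯n≉0 M≄L (concurrent⇒span X∈L X∈M X∈n L≄n e)

  normalForm : ∀ {L n M} → InPencil L n M → Triple
  normalForm {L} {n} D = InPencil.ν D • coords L ⊕ coords n

  ∈M⇒·normalForm≈0 : ∀ {L n M Q} (D : InPencil L n M) → Q ∈ M → coords Q · normalForm D ≈ 0#
  ∈M⇒·normalForm≈0 {L} {n} {M} {Q} D (incident Q·M≈0) = x*y≈0⇒y≈0 κ≉0 (begin
    κ * (coords Q · normalForm D)  ≈⟨ ·-•ʳ (coords Q) κ (normalForm D) ⟨
    coords Q · κ • normalForm D    ≈⟨ ·-congʳ (coords Q) coords≐ ⟨
    coords Q · coords M            ≈⟨ Q·M≈0 ⟩
    0#                             ∎)
    where
    open InPencil D
    open ≈-Reasoning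

  ∈L⇒·normalForm≈·n : ∀ {L n M P} (D : InPencil L n M) → P ∈ L → coords P · normalForm D ≈ coords P · coords n
  ∈L⇒·normalForm≈·n {L} {n} {M} {P} D (incident P·L≈0) = begin
    coords P · ν • coords L ⊕ coords n      ≈⟨ ·-⊕ʳ (coords P) (ν • coords L) (coords n) ⟩
    (coords P · ν • coords L) + p·n         ≈⟨ +-congʳ (·-•ʳ (coords P) ν (coords L)) ⟩
    ν * (coords P · coords L) + p·n         ≈⟨ +-congʳ (trans (*-congˡ P·L≈0) (zeroʳ ν)) ⟩
    0# + p·n                                ≈⟨ +-identityˡ p·n ⟩
    p·n                                     ∎
    where
    open InPencil D
    open ≈-Reasoning
    p·n = coords P · coords n

  normalForm-injective : ∀ {L n M L′ M′} (D : InPencil L n M) (D′ : InPencil L′ n M′) →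
                         normalForm D ≐ normalForm D′ → M ≃ M′
  normalForm-injective {M = M} {M′ = M′} D D′ N≐N′ = ≐•⇒≃ M M′ (begin
    coords M                            ≈⟨ InPencil.coords≐ D ⟩
    κ • normalForm D                    ≈⟨ •-congˡ κ N≐N′ ⟩
    κ • normalForm D′                   ≈⟨ •-congˡ κ (•-divide (InPencil.κ≉0 D′) (≐-sym (InPencil.coords≐ D′))) ⟩
    κ • κ′⁻¹ • coords M′                ≈⟨ •-assoc κ κ′⁻¹ (coords M′) ⟩
    (κ * κ′⁻¹) • coords M′              ∎)
    where
    open ≐-Reasoning
    κ = InPencil.κ D
    κ′⁻¹ = inverse (InPencil.κ D′) (InPencil.κ≉0 D′)

  joining : ∀ {L n M L′ M′} (D : InPencil L n M) (D′ : InPencil L′ n M′) → M ≄ M′ → Vec3 F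
  joining D D′ M≄M′ = vec3 (normalForm D ⊝ normalForm D′) λ N⊝N′≐𝟎 → M≄M′ (normalForm-injective D D′ (⊝≐𝟎⇒≐ N⊝N′≐𝟎))

  module _ {L n M L′ M′} (D : InPencil L n M) (D′ : InPencil L′ n M′) (M≄M′ : M ≄ M′) where

    ·-joining : ∀ p → coords p · coords (joining D D′ M≄M′) ≈ (coords p · normalForm D) - (coords p · normalForm D′)
    ·-joining p = ·-⊝ʳ (coords p) (normalForm D) (normalForm D′)

    L-vertex∈joining : ∀ {P} → P ∈ L → P ∈ L′ → P ∈ joining D D′ M≄M′
    L-vertex∈joining {P} P∈L P∈L′ = incident (trans (·-joining P)
      (trans (+-cong (∈L⇒·normalForm≈·n D P∈L) (-‿cong (∈L⇒·normalForm≈·n D′ P∈L′))) (-‿inverseʳ _)))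

    M-vertex∈joining : ∀ {Q} → Q ∈ M → Q ∈ M′ → Q ∈ joining D D′ M≄M′
    M-vertex∈joining {Q} Q∈M Q∈M′ = incident (trans (·-joining Q)
      (trans (+-cong (∈M⇒·normalForm≈0 D Q∈M) (-‿cong (∈M⇒·normalForm≈0 D′ Q∈M′))) (-‿inverseʳ 0#)))

  record Joins (m L L′ M M′ : Vec3 F) : Set (c ⊔ ℓ) where
    field
      {P Q} : Vec3 F
      P≄Q : P ≄ Q
      P∈L : P ∈ L
      P∈L′ : P ∈ L′
      Q∈M : Q ∈ M
      Q∈M′ : Q ∈ M′
      P∈m : P ∈ m
      Q∈m : Q ∈ m

  ≃-joining : ∀ {L n M L′ M′ m} (D : InPencil L n M) (D′ : InPencil L′ n M′) (M≄M′ : M ≄ M′) →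
              Joins m L L′ M M′ → m ≃ joining D D′ M≄M′
  ≃-joining D D′ M≄M′ J =
    join-unique P≄Q P∈m Q∈m (L-vertex∈joining D D′ M≄M′ P∈L P∈L′) (M-vertex∈joining D D′ M≄M′ Q∈M Q∈M′)
    where open Joins J

  joining-cycle : ∀ {n L₀ L₁ L₂ M₀ M₁ M₂ p} (D₀ : InPencil L₀ n M₀) (D₁ : InPencil L₁ n M₁) (D₂ : InPencil L₂ n M₂)
                  (M₁≄M₂ : M₁ ≄ M₂) (M₂≄M₀ : M₂ ≄ M₀) (M₀≄M₁ : M₀ ≄ M₁) →
                  p ∈ joining D₁ D₂ M₁≄M₂ → p ∈ joining D₂ D₀ M₂≄M₀ → p ∈ joining D₀ D₁ M₀≄M₁
  joining-cycle {p = p} D₀ D₁ D₂ M₁≄M₂ M₂≄M₀ M₀≄M₁ (incident p∈w₀) (incident p∈w₁) =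
    incident (trans (·-joining D₀ D₁ M₀≄M₁ p) (x≈y⇒x∙y⁻¹≈ε (begin
      a₀ ≈⟨ x∙y⁻¹≈ε⇒x≈y a₂ a₀ (trans (sym (·-joining D₂ D₀ M₂≄M₀ p)) p∈w₁) ⟨
      a₂ ≈⟨ x∙y⁻¹≈ε⇒x≈y a₁ a₂ (trans (sym (·-joining D₁ D₂ M₁≄M₂ p)) p∈w₀) ⟨
      a₁ ∎)))
    where
    open ≈-Reasoning
    a₀ = coords p · normalForm D₀
    a₁ = coords p · normalForm D₁
    a₂ = coords p · normalForm D₂

  desargues : ∀ {n L₀ L₁ L₂ M₀ M₁ M₂ m₀ m₁ m₂} →
              InPencil L₀ n M₀ → InPencil L₁ n M₁ → InPencil L₂ n M₂ →
              M₁ ≄ M₂ → M₂ ≄ M₀ → M₀ ≄ M₁ →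
              Joins m₀ L₁ L₂ M₁ M₂ → Joins m₁ L₂ L₀ M₂ M₀ → Joins m₂ L₀ L₁ M₀ M₁ →
              ∃ λ p → p ∈ m₀ × p ∈ m₁ × p ∈ m₂
  desargues D₀ D₁ D₂ M₁≄M₂ M₂≄M₀ M₀≄M₁ J₀ J₁ J₂ =
    let p , p∈w₀ , p∈w₁ = meet (joining D₁ D₂ M₁≄M₂) (joining D₂ D₀ M₂≄M₀)
    in p , ∈-respʳ (≃-sym (≃-joining D₁ D₂ M₁≄M₂ J₀)) p∈w₀
         , ∈-respʳ (≃-sym (≃-joining D₂ D₀ M₂≄M₀ J₁)) p∈w₁
         , ∈-respʳ (≃-sym (≃-joining D₀ D₁ M₀≄M₁ J₂)) (joining-cycle D₀ D₁ D₂ M₁≄M₂ M₂≄M₀ M₀≄M₁ p∈w₀ p∈w₁)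

  Joins-resp : ∀ {m L L′ M M′ L₁ L₁′ M₁ M₁′} → L ≃ L₁ → L′ ≃ L₁′ → M ≃ M₁ → M′ ≃ M₁′ →
               Joins m L L′ M M′ → Joins m L₁ L₁′ M₁ M₁′
  Joins-resp L≃L₁ L′≃L₁′ M≃M₁ M′≃M₁′ J = record
    { P≄Q = P≄Q
    ; P∈L = ∈-respʳ L≃L₁ P∈L ; P∈L′ = ∈-respʳ L′≃L₁′ P∈L′
    ; Q∈M = ∈-respʳ M≃M₁ Q∈M ; Q∈M′ = ∈-respʳ M′≃M₁′ Q∈M′
    ; P∈m = P∈m ; Q∈m = Q∈m
    }
    where open Joins J

HasSize⇒decidable : ∀ {c ℓ} (F : CommutativeRing c ℓ) {n} → HasSize F n → Decidable (CommutativeRing._≈_ F)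
HasSize⇒decidable F (f , f-injective , f-surjective) x y with f-surjective x | f-surjective y
... | i , fi≈x | j , fj≈y with i Fin.≟ j
... | yes ≡.refl = yes (trans (sym fi≈x) fj≈y) where open CommutativeRing F
... | no i≢j = no (λ x≈y → i≢j (f-injective i j (trans fi≈x (trans x≈y (sym fj≈y))))) where open CommutativeRing F

module OrderThreeCollineation {c ℓ} (F : CommutativeRing c ℓ) (isField : IsField F)
  (_≟_ : Decidable (CommutativeRing._≈_ F)) (α : Collineation F)
  (pt³∼id : ∀ x → _∼_ F (Setting.pt³ F α x) x) where

  open ProjectivePlane F isField _≟_
  open Collineation α
  open Setting F α

  pt-∈ : ∀ {p l} → p ∈ l → pt p ∈ ln l
  pt-∈ {p} {l} (incident p·l≈0) = incident (proj₁ (incidence p l) p·l≈0)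

  ln-≃ : ∀ {l l′} → l ≃ l′ → ln l ≃ ln l′
  ln-≃ {l} {l′} l≃l′ = ∼⇒≃ (ln-cong {l} {l′} (≃⇒∼ l≃l′))

  ln-≄ : ∀ {l l′} → l ≄ l′ → ln l ≄ ln l′
  ln-≄ {l} {l′} l≄l′ αl≃αl′ = l≄l′ (∼⇒≃ (ln-inj {l} {l′} (≃⇒∼ αl≃αl′)))

  pt-≄ : ∀ {p p′} → p ≄ p′ → pt p ≄ pt p′
  pt-≄ {p} {p′} p≄p′ αp≃αp′ = p≄p′ (∼⇒≃ (pt-inj {p} {p′} (≃⇒∼ αp≃αp′)))

  ln³≃id : ∀ l → ln (ln (ln l)) ≃ l
  ln³≃id l =
    let p , r , p≄r , p∈l , r∈l = twoPointsOn l
    in join-unique p≄r (α³-∈ p∈l) (α³-∈ r∈l) p∈l r∈l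
    where
    α³-∈ : ∀ {p} → p ∈ l → p ∈ ln (ln (ln l))
    α³-∈ {p} p∈l = ∈-respˡ (∼⇒≃ (pt³∼id p)) (pt-∈ (pt-∈ (pt-∈ p∈l)))

  ln-fixes : ∀ {n l} → ln n ≃ n → l ≃ n → ln l ≃ l
  ln-fixes {n} {l} αn≃n l≃n = begin
    ln l  ≈⟨ ln-≃ l≃n ⟩
    ln n  ≈⟨ αn≃n ⟩
    n     ≈⟨ l≃n ⟨
    l     ∎
    where open ≃-Reasoning

  module _ {l} (l∈ℒ₃ : ℒ₃ l) where

    ℒ₃-l≄αl : l ≄ ln l
    ℒ₃-l≄αl = ¬∼⇒≄ (proj₁ l∈ℒ₃)

    ℒ₃-αl≄α²l : ln l ≄ ln² l
    ℒ₃-αl≄α²l = ¬∼⇒≄ (proj₁ (proj₂ l∈ℒ₃))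

    ℒ₃-l≄α²l : l ≄ ln² l
    ℒ₃-l≄α²l = ¬∼⇒≄ (proj₁ (proj₂ (proj₂ l∈ℒ₃)))

    ℒ₃-not-concurrent : ∀ {p} → p ∈ l → p ∈ ln l → p ∈ ln² l → ⊥
    ℒ₃-not-concurrent {p} (incident p∈l) (incident p∈αl) (incident p∈α²l) =
      proj₂ (proj₂ (proj₂ l∈ℒ₃)) (p , p∈l , p∈αl , p∈α²l)

    ℒ₃-l≄fixed : ∀ {n} → ln n ≃ n → l ≄ n
    ℒ₃-l≄fixed αn≃n l≃n = ℒ₃-l≄αl (≃-sym (ln-fixes αn≃n l≃n))

    ℒ₃-αl≄fixed : ∀ {n} → ln n ≃ n → ln l ≄ n
    ℒ₃-αl≄fixed αn≃n αl≃n = ℒ₃-αl≄α²l (≃-sym (ln-fixes αn≃n αl≃n))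

    ℒ₃-α²l≄fixed : ∀ {n} → ln n ≃ n → ln² l ≄ n
    ℒ₃-α²l≄fixed αn≃n α²l≃n = ℒ₃-l≄α²l (≃-trans (≃-sym (ln³≃id l)) (ln-fixes αn≃n α²l≃n))

    module _ {P} (μ : IsMu l P) where

      μ-on-αl : P ∈ ln l
      μ-on-αl = incident (proj₁ μ)

      μ-on-α²l : P ∈ ln² l
      μ-on-α²l = incident (proj₂ μ)

      αμ-on-α²l : pt P ∈ ln² l
      αμ-on-α²l = pt-∈ μ-on-αl

      αμ-on-l : pt P ∈ l
      αμ-on-l = ∈-respʳ (ln³≃id l) (pt-∈ μ-on-α²l)

      α²μ-on-l : pt² P ∈ l
      α²μ-on-l = ∈-respʳ (ln³≃id l) (pt-∈ (pt-∈ μ-on-αl))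

      α²μ-on-αl : pt² P ∈ ln l
      α²μ-on-αl = ∈-respʳ (ln-≃ (ln³≃id l)) (pt-∈ (pt-∈ μ-on-α²l))

      μ-not-collinear : ∀ {k} → P ∈ k → pt P ∈ k → pt² P ∈ k → ⊥
      μ-not-collinear P∈k αP∈k α²P∈k =
        ℒ₃-not-concurrent α²μ-on-l α²μ-on-αl (∈-respʳ (join-unique P≄αP P∈k αP∈k μ-on-α²l αμ-on-α²l) α²P∈k)
        where
        P≄αP : P ≄ pt P
        P≄αP P≃αP = ℒ₃-not-concurrent αμ-on-l (∈-respˡ P≃αP μ-on-αl) αμ-on-α²l

      μ-line-not-fixed : ∀ {m} → P ∈ m → m ≄ ln m
      μ-line-not-fixed {m} P∈m m≃αm =
        μ-not-collinear P∈m (∈-respʳ (≃-sym m≃αm) (pt-∈ P∈m)) (∈-respʳ α²m≃m (pt-∈ (pt-∈ P∈m)))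
        where
        α²m≃m : ln² m ≃ m
        α²m≃m = ≃-sym (≃-trans m≃αm (ln-≃ m≃αm))

  record Axis (X : Vec3 F) : Set (c ⊔ ℓ) where
    field
      n : Vec3 F
      αn≃n : ln n ≃ n
      X∈n : X ∈ n
      αX∈n : pt X ∈ n
      α²X∈n : pt² X ∈ n

  𝒪₂-axis : ∀ {X} → 𝒪₂ X → Axis X
  𝒪₂-axis (_ , αX≁α²X , _ , n , X∈n , αX∈n , α²X∈n) = record
    { n = n
    ; αn≃n = join-unique (¬∼⇒≄ αX≁α²X) (pt-∈ (incident X∈n)) (pt-∈ (incident αX∈n)) (incident αX∈n) (incident α²X∈n)
    ; X∈n = incident X∈n ; αX∈n = incident αX∈n ; α²X∈n = incident α²X∈n
    }

  ℒ₂-intro : ∀ {m} → m ≄ ln m → (∃ λ p → p ∈ m × p ∈ ln m × p ∈ ln² m) → ℒ₂ m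
  ℒ₂-intro {m} m≄αm (p , incident p∈m , incident p∈αm , incident p∈α²m) =
    ≄⇒¬∼ m≄αm , ≄⇒¬∼ (ln-≄ m≄αm) ,
    (λ m∼α²m → m≄αm (≃-sym (≃-trans (ln-≃ (∼⇒≃ m∼α²m)) (ln³≃id m)))) ,
    (p , p∈m , p∈αm , p∈α²m)

  Joins-pt : ∀ {m L L′ M M′} → Joins m L L′ M M′ → Joins (ln m) (ln L) (ln L′) (ln M) (ln M′)
  Joins-pt J = record
    { P≄Q = pt-≄ P≄Q
    ; P∈L = pt-∈ P∈L ; P∈L′ = pt-∈ P∈L′ ; Q∈M = pt-∈ Q∈M ; Q∈M′ = pt-∈ Q∈M′
    ; P∈m = pt-∈ P∈m ; Q∈m = pt-∈ Q∈m
    }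
    where open Joins J

  Joins-orbit : ∀ {m ℓ₁ ℓ₂} → Joins m (ln ℓ₁) (ln² ℓ₁) (ln ℓ₂) (ln² ℓ₂) →
                Joins (ln m) (ln² ℓ₁) ℓ₁ (ln² ℓ₂) ℓ₂ × Joins (ln² m) ℓ₁ (ln ℓ₁) ℓ₂ (ln ℓ₂)
  Joins-orbit {m} {ℓ₁} {ℓ₂} J₀ = J₁ , Joins-resp (ln³≃id ℓ₁) ≃-refl (ln³≃id ℓ₂) ≃-refl (Joins-pt J₁)
    where
    J₁ : Joins (ln m) (ln² ℓ₁) ℓ₁ (ln² ℓ₂) ℓ₂
    J₁ = Joins-resp ≃-refl (ln³≃id ℓ₁) ≃-refl (ln³≃id ℓ₂) (Joins-pt J₀)

  μ-distinct : ∀ {X ℓ₁ ℓ₂ P₁ P₂} → ℓ₁ ≄ ℓ₂ → X ∈ ℓ₁ → X ∈ ℓ₂ → pt X ≄ pt² X →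
               IsMu ℓ₁ P₁ → IsMu ℓ₂ P₂ → P₁ ≄ P₂
  μ-distinct {X} {ℓ₁} {ℓ₂} {P₁} ℓ₁≄ℓ₂ X∈ℓ₁ X∈ℓ₂ αX≄α²X (P₁∈αℓ₁ , P₁∈α²ℓ₁) (P₂∈αℓ₂ , P₂∈α²ℓ₂) P₁≃P₂ =
    αX≄α²X (begin
      pt X   ≈⟨ meet-unique (ln-≄ ℓ₁≄ℓ₂) (pt-∈ X∈ℓ₁) (pt-∈ X∈ℓ₂) (incident P₁∈αℓ₁) P₁∈αℓ₂ ⟩
      P₁     ≈⟨ meet-unique (ln-≄ (ln-≄ ℓ₁≄ℓ₂)) (incident P₁∈α²ℓ₁) P₁∈α²ℓ₂ (pt-∈ (pt-∈ X∈ℓ₁)) (pt-∈ (pt-∈ X∈ℓ₂)) ⟩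
      pt² X  ∎)
    where
    open ≃-Reasoning
    P₁∈αℓ₂ : P₁ ∈ ln ℓ₂
    P₁∈αℓ₂ = ∈-respˡ (≃-sym P₁≃P₂) (incident P₂∈αℓ₂)
    P₁∈α²ℓ₂ : P₁ ∈ ln² ℓ₂
    P₁∈α²ℓ₂ = ∈-respˡ (≃-sym P₁≃P₂) (incident P₂∈α²ℓ₂)

  μ-join-ℒ₂ : ∀ {ℓ₁ ℓ₂ X P₁ P₂ m} → ℒ₃ ℓ₁ → ℒ₃ ℓ₂ → ℓ₁ ≄ ℓ₂ → X ∈ ℓ₁ → X ∈ ℓ₂ → 𝒪₂ X →
              IsMu ℓ₁ P₁ → IsMu ℓ₂ P₂ → P₁ ∈ m → P₂ ∈ m → ℒ₂ m
  μ-join-ℒ₂ {ℓ₁} {ℓ₂} {X} {P₁} {P₂} {m} ℓ₁∈ℒ₃ ℓ₂∈ℒ₃ ℓ₁≄ℓ₂ X∈ℓ₁ X∈ℓ₂ X∈𝒪₂ μ₁ μ₂ P₁∈m P₂∈m =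
    ℒ₂-intro (μ-line-not-fixed ℓ₁∈ℒ₃ μ₁ P₁∈m)
      (desargues D₀ D₁ D₂ (ℒ₃-αl≄α²l ℓ₂∈ℒ₃) (≄-sym (ℒ₃-l≄α²l ℓ₂∈ℒ₃)) (ℒ₃-l≄αl ℓ₂∈ℒ₃) J₀ J₁ J₂)
    where
    open Axis (𝒪₂-axis X∈𝒪₂)
    ℓ₂≄ℓ₁ : ℓ₂ ≄ ℓ₁
    ℓ₂≄ℓ₁ = ≄-sym ℓ₁≄ℓ₂

    D₀ : InPencil ℓ₁ n ℓ₂
    D₀ = inPencil X∈ℓ₁ X∈ℓ₂ X∈n (ℒ₃-l≄fixed ℓ₁∈ℒ₃ αn≃n) ℓ₂≄ℓ₁
    D₁ : InPencil (ln ℓ₁) n (ln ℓ₂)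
    D₁ = inPencil (pt-∈ X∈ℓ₁) (pt-∈ X∈ℓ₂) αX∈n (ℒ₃-αl≄fixed ℓ₁∈ℒ₃ αn≃n) (ln-≄ ℓ₂≄ℓ₁)
    D₂ : InPencil (ln² ℓ₁) n (ln² ℓ₂)
    D₂ = inPencil (pt-∈ (pt-∈ X∈ℓ₁)) (pt-∈ (pt-∈ X∈ℓ₂)) α²X∈n (ℒ₃-α²l≄fixed ℓ₁∈ℒ₃ αn≃n) (ln-≄ (ln-≄ ℓ₂≄ℓ₁))

    J₀ : Joins m (ln ℓ₁) (ln² ℓ₁) (ln ℓ₂) (ln² ℓ₂)
    J₀ = record
      { P≄Q = μ-distinct ℓ₁≄ℓ₂ X∈ℓ₁ X∈ℓ₂ (¬∼⇒≄ (proj₁ (proj₂ X∈𝒪₂))) μ₁ μ₂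
      ; P∈L = μ-on-αl ℓ₁∈ℒ₃ μ₁ ; P∈L′ = μ-on-α²l ℓ₁∈ℒ₃ μ₁
      ; Q∈M = μ-on-αl ℓ₂∈ℒ₃ μ₂ ; Q∈M′ = μ-on-α²l ℓ₂∈ℒ₃ μ₂
      ; P∈m = P₁∈m ; Q∈m = P₂∈m
      }
    J₁ : Joins (ln m) (ln² ℓ₁) ℓ₁ (ln² ℓ₂) ℓ₂
    J₁ = proj₁ (Joins-orbit J₀)
    J₂ : Joins (ln² m) ℓ₁ (ln ℓ₁) ℓ₂ (ln ℓ₂)
    J₂ = proj₂ (Joins-orbit J₀)

lemma6 : {c ℓ c′ ℓ′ : Level} (q : ℕ) → 2 < q → IsPrimePower q →
         (K : CommutativeRing c′ ℓ′) → IsField K → HasSize K q →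
         (F : CommutativeRing c ℓ) → IsField F → HasSize F (q ^ 3) →
         (α : Collineation F) →
         Setting.HasOrder3 F α → Setting.FixedSubplaneIso F α K →
         (ℓ₁ ℓ₂ : Line F) →
         Setting.ℒ₃ F α ℓ₁ → Setting.ℒ₃ F α ℓ₂ → ¬ (_∼_ F ℓ₁ ℓ₂) →
         (∃ λ (X : Point F) → _I_ F X ℓ₁ × _I_ F X ℓ₂ × Setting.𝒪₂ F α X) →
         (P₁ P₂ : Point F) → Setting.IsMu F α ℓ₁ P₁ → Setting.IsMu F α ℓ₂ P₂ →
         (m : Line F) → _I_ F P₁ m → _I_ F P₂ m →
         Setting.ℒ₂ F α m
lemma6 _ _ _ _ _ _ F isField F-finite α (pt³∼id , _) _ ℓ₁ ℓ₂ ℓ₁∈ℒ₃ ℓ₂∈ℒ₃ ℓ₁≁ℓ₂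
       (X , X∈ℓ₁ , X∈ℓ₂ , X∈𝒪₂) P₁ P₂ μ₁ μ₂ m P₁∈m P₂∈m =
  μ-join-ℒ₂ {ℓ₁} {ℓ₂} {X} {P₁} {P₂} {m} ℓ₁∈ℒ₃ ℓ₂∈ℒ₃ (¬∼⇒≄ ℓ₁≁ℓ₂)
    (incident X∈ℓ₁) (incident X∈ℓ₂) X∈𝒪₂ μ₁ μ₂ (incident P₁∈m) (incident P₂∈m)
  where
  open ProjectivePlane F isField (HasSize⇒decidable F F-finite)
  open OrderThreeCollineation F isField (HasSize⇒decidable F F-finite) α pt³∼id
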